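{- For all non-negative integers $n,a,b,r$, \[ \binom{n+a+b}{r}\ge\binom{n+a}{r}+\binom{n+b}{r}-\binom{n}{r}. \] -}

module Defs where

-- Pascal's rule shows that the increment (n + b) C r - n C r is itself a sum of binomial
-- coefficients with upper index at least n, so it can only grow when n is replaced by m ≥ n.
module Submission where

open import Defs
open import Data.Nat using (ℕ)
open import Data.Nat.Combinatorics using (_C_; nCk+nC[k+1]≡[n+1]C[k+1])
open import Data.Integer using (ℤ; +_; _+_; _-_; _≥_)
open import Data.Nat as ℕ using (zero; suc; _≤_; z≤n; s≤s)
open import Data.Nat.Properties as ℕ using (+-commutativeSemigroup)
open import Data.Integer as ℤ using (_⊖_)
import Data.Integer.Properties as ℤ
open import Algebra.Properties.CommutativeSemigroup +-commutativeSemigroup using (x∙yz≈y∙xz)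
open import Relation.Binary.PropositionalEquality using (cong; sym)

C-monoˡ-≤ : ∀ {m n} k → m ≤ n → m C k ≤ n C k
C-monoˡ-≤ zero    _         = ℕ.≤-refl
C-monoˡ-≤ (suc k) z≤n       = z≤n
C-monoˡ-≤ {suc m} {suc n} (suc k) (s≤s m≤n)
  rewrite sym (nCk+nC[k+1]≡[n+1]C[k+1] m k) | sym (nCk+nC[k+1]≡[n+1]C[k+1] n k) =
  ℕ.+-mono-≤ (C-monoˡ-≤ k m≤n) (C-monoˡ-≤ (suc k) m≤n)

mCk+[n+b]Ck≤[m+b]Ck+nCk : ∀ {m n} b k → n ≤ m →
                          m C k ℕ.+ (n ℕ.+ b) C k ≤ (m ℕ.+ b) C k ℕ.+ n C k
mCk+[n+b]Ck≤[m+b]Ck+nCk {m} {n} zero k _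
  rewrite ℕ.+-identityʳ m | ℕ.+-identityʳ n = ℕ.≤-refl
mCk+[n+b]Ck≤[m+b]Ck+nCk (suc b) zero _ = ℕ.≤-refl
mCk+[n+b]Ck≤[m+b]Ck+nCk {m} {n} (suc b) (suc k) n≤m
  rewrite ℕ.+-suc n b | ℕ.+-suc m b
        | sym (nCk+nC[k+1]≡[n+1]C[k+1] (n ℕ.+ b) k)
        | sym (nCk+nC[k+1]≡[n+1]C[k+1] (m ℕ.+ b) k) = begin
  m C suc k ℕ.+ ((n ℕ.+ b) C k ℕ.+ (n ℕ.+ b) C suc k)
    ≡⟨ x∙yz≈y∙xz (m C suc k) ((n ℕ.+ b) C k) ((n ℕ.+ b) C suc k) ⟩
  (n ℕ.+ b) C k ℕ.+ (m C suc k ℕ.+ (n ℕ.+ b) C suc k)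
    ≤⟨ ℕ.+-mono-≤ (C-monoˡ-≤ k (ℕ.+-monoˡ-≤ b n≤m)) (mCk+[n+b]Ck≤[m+b]Ck+nCk b (suc k) n≤m) ⟩
  (m ℕ.+ b) C k ℕ.+ ((m ℕ.+ b) C suc k ℕ.+ n C suc k)
    ≡⟨ ℕ.+-assoc ((m ℕ.+ b) C k) ((m ℕ.+ b) C suc k) (n C suc k) ⟨
  (m ℕ.+ b) C k ℕ.+ (m ℕ.+ b) C suc k ℕ.+ n C suc k ∎
  where open ℕ.≤-Reasoning

m≤n+o⇒m-o≤n : ∀ {m n o} → m ≤ n ℕ.+ o → + m - + o ℤ.≤ + n
m≤n+o⇒m-o≤n {m} {n} {o} m≤n+o = begin
  + m - + o         ≡⟨ ℤ.m-n≡m⊖n m o ⟩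
  m ⊖ o             ≤⟨ ℤ.⊖-monoˡ-≤ o m≤n+o ⟩
  n ℕ.+ o ⊖ o       ≡⟨ ℤ.⊖-≥ (ℕ.m≤n+m o n) ⟩
  + (n ℕ.+ o ℕ.∸ o) ≡⟨ cong +_ (ℕ.m+n∸n≡m n o) ⟩
  + n               ∎
  where open ℤ.≤-Reasoning

lemma3p7 : (n a b r : ℕ) →
    + ((n Data.Nat.+ a Data.Nat.+ b) C r) ≥ (+ ((n Data.Nat.+ a) C r) + + ((n Data.Nat.+ b) C r)) - + (n C r)
lemma3p7 n a b r rewrite sym (ℤ.pos-+ ((n ℕ.+ a) C r) ((n ℕ.+ b) C r)) =
  m≤n+o⇒m-o≤n (mCk+[n+b]Ck≤[m+b]Ck+nCk b r (ℕ.m≤m+n n a))
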